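{- Let $p$ be a prime with $p>48$, let $N$ be a multiple of $p^2$, and let $F:\mathbb{B}\to(\mathbb{Z}/p\mathbb{Z})^\times$ be an $\mathcal{S}_{p,N}$-Sudoku solution. Then there exist integers $n_0,m_0$ with $0\le n_0\le N-4$ and integers $A,B,C$, not all divisible by $p$, such that for all $(n,m)\in Q_{n_0,m_0}=\{n_0,\dots,n_0+3\}\times\{m_0,\dots,m_0+3\}$ one has $F(n,m)=\pi_p(An+Bm+C)$ and $\nu_p(An+Bm+C)=0$.
   Context: $\pi_p:\mathbb{Z}\to\mathbb{Z}/p\mathbb{Z}$ is reduction mod $p$, $(\mathbb{Z}/p\mathbb{Z})^\times=(\mathbb{Z}/p\mathbb{Z})\setminus\{0\}$, $\nu_p$ is the $p$-adic valuation with $\nu_p(0)=+\infty$. Define $f_p(n)=\pi_p(n/p^{\nu_p(n)})$ for $n\ne0$ and $f_p(0)=1\bmod p$. The Sudoku board is $\mathbb{B}=\{0,\dots,N-1\}\times\mathbb{Z}$. The Sudoku rule $\mathcal{S}_{p,N}$ is the set of functions $g:\{0,\dots,N-1\}\to(\mathbb{Z}/p\mathbb{Z})^\times$ for which there exist integers $a,b$, not both divisible by $p$, such that $g(n)=f_p(an+b)$ for all $n\in\{0,\dots,N-1\}$ with $\nu_p(an+b)\le1$. An $\mathcal{S}_{p,N}$-Sudoku solution is $F:\mathbb{B}\to(\mathbb{Z}/p\mathbb{Z})^\times$ such that for all $j,i\in\mathbb{Z}$ the function $n\mapsto F(n,jn+i)$ lies in $\mathcal{S}_{p,N}$. -}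

module Defs where

open import Data.Nat as ℕ using (ℕ; NonZero)
open import Data.Fin using (Fin; toℕ; fromℕ<)
open import Data.Integer as ℤ using (ℤ; +_; _%ℕ_)
open import Data.Integer.DivMod using (n%ℕd<d)
open import Data.Integer.Divisibility using (_∣_)
open import Data.Product using (Σ; ∃; ∃-syntax; _×_; proj₁)
open import Data.Sum using (_⊎_)
open import Relation.Binary.PropositionalEquality using (_≡_; _≢_)
open import Relation.Nullary using (¬_)

-- Z/pZ is modelled by Fin p (residues 0..p-1).
-- π_p : ℤ → ℤ/pℤ, reduction mod p.
π : (p : ℕ) .{{_ : NonZero p}} → ℤ → Fin p
π p z = fromℕ< (n%ℕd<d z p)

Units : (p : ℕ) → Set
Units p = Σ (Fin p) (λ x → toℕ x ≢ 0)

-- ν_p(x) ≤ 1  (with ν_p(0) = +∞), i.e. p² ∤ x.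
ν≤1 : ℕ → ℤ → Set
ν≤1 p x = ¬ ((+ (p ℕ.* p)) ∣ x)

ν≡0 : ℕ → ℤ → Set
ν≡0 p x = ¬ ((+ p) ∣ x)

-- Graph of f_p : "f_p(x) ≡ u".
-- f_p(0) = 1 mod p; for x ≠ 0, f_p(x) = π_p(x / p^{ν_p(x)}), i.e. the reduction
-- of the unique m with x = p^k m and p ∤ m.
IsFp : (p : ℕ) .{{_ : NonZero p}} → ℤ → Fin p → Set
IsFp p x u =
  (x ≡ + 0 × u ≡ π p (+ 1))
  ⊎ (x ≢ + 0 × ∃[ k ] ∃[ m ] (x ≡ (+ (p ℕ.^ k)) ℤ.* m × ν≡0 p m × u ≡ π p m))

InRule : (p N : ℕ) .{{_ : NonZero p}} → (Fin N → Units p) → Set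
InRule p N g =
  ∃[ a ] ∃[ b ] (¬ ((+ p) ∣ a × (+ p) ∣ b)
     × ((n : Fin N) → ν≤1 p (a ℤ.* (+ toℕ n) ℤ.+ b)
          → IsFp p (a ℤ.* (+ toℕ n) ℤ.+ b) (proj₁ (g n))))

-- Board B = {0..N-1} × ℤ ; S_{p,N}-Sudoku solutions.
IsSudokuSolution : (p N : ℕ) .{{_ : NonZero p}} → (Fin N → ℤ → Units p) → Set
IsSudokuSolution p N F =
  (j i : ℤ) → InRule p N (λ n → F n (j ℤ.* (+ toℕ n) ℤ.+ i))

-- Call a cell (n, m) bad when the row through it, or the diagonal of slope 1 through it,
-- has its Sudoku line a·n + b divisible by p at n.  A nondegenerate line vanishes mod p at
-- most once among p consecutive columns, so [0, 4p)² holds at most 4p·4 + 8p·4 = 48p bad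
-- cells, fewer than its p² aligned 4×4 squares: some square Q has no bad cell.  On Q every
-- row and every diagonal of slope 1 agrees mod p with an affine function of the column, and
-- the antidiagonal does so at all but at most one cell.  Expressing each value of Q as an
-- integer combination of v₀₀, v₁₀, v₀₁ and the mixed difference E = v₁₁ − v₁₀ − v₀₁ + v₀₀,
-- these relations give v ≡ (affine) + d·E cell by cell, and the antidiagonal then gives
-- 4E ≡ 0 or 12E ≡ 0, so E ≡ 0 and F is affine on Q.  Its values are units, so the affine
-- function does not vanish mod p on Q.

module Submission where

open import Agda.Builtin.FromNat using (Number; fromNat)
open import Agda.Builtin.FromNeg using (Negative; fromNeg)
import Data.Nat.Literals as ℕLiterals
import Data.Integer.Literals as ℤLiterals

open import Defs
open import Data.Nat as ℕ using (ℕ; NonZero; zero; suc; z≤n; s≤s)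
import Data.Nat.Properties as ℕP
import Data.Nat.Divisibility as ℕD
import Data.Nat.DivMod as ℕDivMod
open import Data.Nat.Primality using (Prime; euclidsLemma)
open import Data.Fin using (Fin; toℕ; fromℕ<; combine; remQuot; join; splitAt)
open import Data.Fin.Patterns using (0F; 1F; 2F; 3F)
import Data.Fin.Properties as FinP
open import Data.Integer as ℤ using (ℤ; +_; -_; _+_; _-_; _*_; _%ℕ_; _/ℕ_)
import Data.Integer.Properties as ℤP
open import Data.Integer.DivMod using (a≡a%ℕn+[a/ℕn]*n)
import Data.Integer.Divisibility.Signed as Signed
open Signed hiding (_∣_)
open import Data.Integer.Tactic.RingSolver using (solve-∀)
open import Data.Product using (∃; ∃₂; ∃-syntax; _×_; _,_; proj₁; proj₂; uncurry)
open import Data.Sum using (_⊎_; inj₁; inj₂; [_,_]′)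
open import Data.Sum.Properties using (inj₁-injective; inj₂-injective)
open import Function.Definitions using (Injective)
open import Relation.Binary.Bundles using (Setoid)
open import Relation.Binary.Structures using (IsEquivalence)
open import Relation.Binary.PropositionalEquality
import Relation.Binary.Reasoning.Setoid as SetoidReasoning
open import Relation.Nullary using (¬_; contradiction; Dec; yes; no; ¬?)
open import Relation.Nullary.Decidable using (_⊎-dec_; decidable-stable)

open import Data.Unit.Base using (tt)

instance
  ℕ-number : Number ℕ
  ℕ-number = ℕLiterals.number
  ℤ-number : Number ℤ
  ℤ-number = ℤLiterals.number
  ℤ-negative : Negative ℤ
  ℤ-negative = ℤLiterals.negative

minus-cancelʳ : ∀ {a b c} → a - c ≡ b - c → a ≡ b
minus-cancelʳ {a} {b} {c} eq = trans (sym (restore a c)) (trans (cong (_+ c) eq) (restore b c))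
  where
  restore : ∀ a c → a - c + c ≡ a
  restore = solve-∀

module Modular (p : ℕ) .{{_ : NonZero p}} where
  open Signed using (_∣_)

  infix 4 _≈_
  record _≈_ (x y : ℤ) : Set where
    constructor ⟨_⟩
    field
      ∣difference : + p ∣ x - y
  open _≈_ public

  ∣-resp-≡ : ∀ {x y} → x ≡ y → + p ∣ x → + p ∣ y
  ∣-resp-≡ = subst (+ p ∣_)

  Nondegenerate : ℤ → ℤ → Set
  Nondegenerate a b = ¬ (+ p ∣ a × + p ∣ b)

  ≈-reflexive : ∀ {x y} → x ≡ y → x ≈ y
  ≈-reflexive {x} refl = ⟨ divides 0 (ℤP.+-inverseʳ x) ⟩

  ≈-sym : ∀ {x y} → x ≈ y → y ≈ x
  ≈-sym {x} {y} ⟨ x≈y ⟩ = ⟨ ∣-resp-≡ (negate x y) (∣m⇒∣-m x≈y) ⟩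
    where
    negate : ∀ x y → - (x - y) ≡ y - x
    negate = solve-∀

  ≈-trans : ∀ {x y z} → x ≈ y → y ≈ z → x ≈ z
  ≈-trans {x} {y} {z} ⟨ x≈y ⟩ ⟨ y≈z ⟩ = ⟨ ∣-resp-≡ (ℤP.+-minus-telescope x y z) (∣m∣n⇒∣m+n x≈y y≈z) ⟩

  ≈-isEquivalence : IsEquivalence _≈_
  ≈-isEquivalence = record { refl = ≈-reflexive refl ; sym = ≈-sym ; trans = ≈-trans }

  ≈-setoid : Setoid _ _
  ≈-setoid = record { isEquivalence = ≈-isEquivalence }

  +-cong : ∀ {x x′ y y′} → x ≈ x′ → y ≈ y′ → x + y ≈ x′ + y′
  +-cong {x} {x′} {y} {y′} ⟨ x≈x′ ⟩ ⟨ y≈y′ ⟩ = ⟨ ∣-resp-≡ (regroup x x′ y y′) (∣m∣n⇒∣m+n x≈x′ y≈y′) ⟩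
    where
    regroup : ∀ x x′ y y′ → (x - x′) + (y - y′) ≡ (x + y) - (x′ + y′)
    regroup = solve-∀

  +-congˡ : ∀ z {x y} → x ≈ y → z + x ≈ z + y
  +-congˡ z = +-cong (≈-reflexive {z} refl)

  +-congʳ : ∀ z {x y} → x ≈ y → x + z ≈ y + z
  +-congʳ z x≈y = +-cong x≈y (≈-reflexive {z} refl)

  *-congˡ : ∀ c {x y} → x ≈ y → c * x ≈ c * y
  *-congˡ c {x} {y} ⟨ x≈y ⟩ = ⟨ ∣-resp-≡ (distrib c x y) (∣n⇒∣m*n c x≈y) ⟩
    where
    distrib : ∀ c x y → c * (x - y) ≡ c * x - c * y
    distrib = solve-∀

  ≈0⇒∣ : ∀ {x} → x ≈ 0 → + p ∣ x
  ≈0⇒∣ {x} ⟨ p∣x-0 ⟩ = ∣-resp-≡ (ℤP.+-identityʳ x) p∣x-0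

  ∣⇒≈0 : ∀ {x} → + p ∣ x → x ≈ 0
  ∣⇒≈0 {x} p∣x = ⟨ ∣-resp-≡ (sym (ℤP.+-identityʳ x)) p∣x ⟩

  toℕ-π≈ : ∀ x → + toℕ (π p x) ≈ x
  toℕ-π≈ x = ⟨ divides (- (x /ℕ p)) (begin
    + toℕ (π p x) - x                              ≡⟨ cong (λ r → + r - x) (FinP.toℕ-fromℕ< _) ⟩
    + (x %ℕ p) - x                                  ≡⟨ cong (λ y → + (x %ℕ p) - y) (a≡a%ℕn+[a/ℕn]*n x p) ⟩
    + (x %ℕ p) - (+ (x %ℕ p) + x /ℕ p * + p)   ≡⟨ cancel (+ (x %ℕ p)) (x /ℕ p) (+ p) ⟩
    - (x /ℕ p) * + p                              ∎) ⟩
    where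
    open ≡-Reasoning
    cancel : ∀ r q d → r - (r + q * d) ≡ - q * d
    cancel = solve-∀

  ∣-small⇒≡0 : ∀ {d} → d ℕ.< p → p ℕD.∣ d → d ≡ 0
  ∣-small⇒≡0 {zero}  _   _   = refl
  ∣-small⇒≡0 {suc d} d<p p∣d = contradiction p∣d (ℕD.>⇒∤ d<p)

  ≈-residue-≥⇒≡ : ∀ {r s} → s ℕ.≤ r → r ℕ.< p → + r ≈ + s → r ≡ s
  ≈-residue-≥⇒≡ {r} {s} s≤r r<p r≈s = ℕP.≤-antisym (ℕP.m∸n≡0⇒m≤n r∸s≡0) s≤r
    where
    r-s≡r∸s : + r - + s ≡ + (r ℕ.∸ s)
    r-s≡r∸s = trans (ℤP.m-n≡m⊖n r s) (ℤP.⊖-≥ s≤r)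
    r∸s≡0 : r ℕ.∸ s ≡ 0
    r∸s≡0 = ∣-small⇒≡0 (ℕP.≤-<-trans (ℕP.m∸n≤m r s) r<p) (∣⇒∣ᵤ (∣-resp-≡ r-s≡r∸s (∣difference r≈s)))

  ≈-residue⇒≡ : ∀ {r s} → r ℕ.< p → s ℕ.< p → + r ≈ + s → r ≡ s
  ≈-residue⇒≡ {r} {s} r<p s<p r≈s with ℕP.≤-total s r
  ... | inj₁ s≤r = ≈-residue-≥⇒≡ s≤r r<p r≈s
  ... | inj₂ r≤s = sym (≈-residue-≥⇒≡ r≤s s<p (≈-sym r≈s))

  ≈-%-residue : ∀ n → + n ≈ + (n ℕ.% p)
  ≈-%-residue n = ⟨ divides (+ q) (begin
    + n - + r                 ≡⟨ cong (λ k → + k - + r) (ℕDivMod.m≡m%n+[m/n]*n n p) ⟩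
    + (r ℕ.+ q ℕ.* p) - + r   ≡⟨ cong (λ k → k - + r) (ℤP.pos-+ r (q ℕ.* p)) ⟩
    + r + + (q ℕ.* p) - + r   ≡⟨ cong (λ k → + r + k - + r) (ℤP.pos-* q p) ⟩
    + r + + q * + p - + r     ≡⟨ cancel (+ r) (+ q) (+ p) ⟩
    + q * + p                 ∎) ⟩
    where
    open ≡-Reasoning
    r q : ℕ
    r = n ℕ.% p
    q = n ℕ./ p
    cancel : ∀ r q d → r + q * d - r ≡ q * d
    cancel = solve-∀

  ≈-and-same-quotient⇒≡ : ∀ {m n} → m ℕ./ p ≡ n ℕ./ p → + m ≈ + n → m ≡ n
  ≈-and-same-quotient⇒≡ {m} {n} m/p≡n/p m≈n = begin
    m                            ≡⟨ ℕDivMod.m≡m%n+[m/n]*n m p ⟩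
    m ℕ.% p ℕ.+ m ℕ./ p ℕ.* p    ≡⟨ cong₂ (λ r q → r ℕ.+ q ℕ.* p) m%p≡n%p m/p≡n/p ⟩
    n ℕ.% p ℕ.+ n ℕ./ p ℕ.* p    ≡⟨ ℕDivMod.m≡m%n+[m/n]*n n p ⟨
    n                            ∎
    where
    open ≡-Reasoning
    m%p≡n%p : m ℕ.% p ≡ n ℕ.% p
    m%p≡n%p = ≈-residue⇒≡ (ℕDivMod.m%n<n m p) (ℕDivMod.m%n<n n p)
      (≈-trans (≈-sym (≈-%-residue m)) (≈-trans m≈n (≈-%-residue n)))

  IsFp⇒≡π : ∀ {x u} → ¬ + p ∣ x → IsFp p x u → u ≡ π p x
  IsFp⇒≡π p∤x (inj₁ (refl , _))                    = contradiction (divides 0 refl) p∤x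
  IsFp⇒≡π p∤x (inj₂ (_ , zero , m , x≡m , _ , u≡)) = trans u≡ (cong (π p) (sym (trans x≡m (ℤP.*-identityˡ m))))
  IsFp⇒≡π p∤x (inj₂ (_ , suc k , m , x≡pᵏ⁺¹m , _ , _)) =
    contradiction (∣-resp-≡ (sym x≡pᵏ⁺¹m) (∣m⇒∣m*n {m = + (p ℕ.^ suc k)} m (∣ᵤ⇒∣ (ℕD.m∣m*n (p ℕ.^ k))))) p∤x

  toℕ≈⇒≡π : ∀ (u : Fin p) x → + toℕ u ≈ x → u ≡ π p x
  toℕ≈⇒≡π u x u≈x = FinP.toℕ-injective (≈-residue⇒≡ (FinP.toℕ<n u) (FinP.toℕ<n (π p x))
    (≈-trans u≈x (≈-sym (toℕ-π≈ x))))

  Collinear : ℤ → ℤ → ℤ → ℤ → ℤ → ℤ → Set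
  Collinear u v w x y z = (w - v) * x + (v - u) * z ≈ (w - u) * y

  collinear : ∀ a b u v w {x y z} → x ≈ a * u + b → y ≈ a * v + b → z ≈ a * w + b →
              Collinear u v w x y z
  collinear a b u v w {x} {y} {z} x≈ y≈ z≈ = begin
    (w - v) * x + (v - u) * z                         ≈⟨ +-cong (*-congˡ (w - v) x≈) (*-congˡ (v - u) z≈) ⟩
    (w - v) * (a * u + b) + (v - u) * (a * w + b)     ≡⟨ interpolate a b u v w ⟩
    (w - u) * (a * v + b)                             ≈⟨ *-congˡ (w - u) (≈-sym y≈) ⟩
    (w - u) * y                                       ∎
    where
    open SetoidReasoning ≈-setoid
    interpolate : ∀ a b u v w → (w - v) * (a * u + b) + (v - u) * (a * w + b) ≡ (w - u) * (a * v + b)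
    interpolate = solve-∀

  module _ {n : ℕ} (v : Fin n → Fin n → ℤ) where

    record AffineAlong (σ c : ℤ) : Set where
      field
        slope intercept : ℤ
        agrees : ∀ k l → + toℕ l ≡ σ * + toℕ k + c → v k l ≈ slope * + toℕ k + intercept

    record AffineAlongExcept (e : Fin n) (σ c : ℤ) : Set where
      field
        slope intercept : ℤ
        agrees : ∀ k l → + toℕ l ≡ σ * + toℕ k + c → k ≢ e → v k l ≈ slope * + toℕ k + intercept

module PrimeModulus (p : ℕ) .{{_ : NonZero p}} (prime : Prime p) where
  open Signed using (_∣_)
  open Modular p

  ∣*⇒∣⊎∣ : ∀ x y → + p ∣ x * y → + p ∣ x ⊎ + p ∣ y
  ∣*⇒∣⊎∣ x y p∣xy with euclidsLemma ℤ.∣ x ∣ ℤ.∣ y ∣ prime (subst (p ℕD.∣_) (ℤP.abs-* x y) (∣⇒∣ᵤ p∣xy))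
  ... | inj₁ p∣x = inj₁ (∣ᵤ⇒∣ p∣x)
  ... | inj₂ p∣y = inj₂ (∣ᵤ⇒∣ p∣y)

  ∣*-cancelˡ : ∀ {c x} → ¬ + p ∣ c → + p ∣ c * x → + p ∣ x
  ∣*-cancelˡ {c} {x} p∤c p∣cx with ∣*⇒∣⊎∣ c x p∣cx
  ... | inj₁ p∣c = contradiction p∣c p∤c
  ... | inj₂ p∣x = p∣x

  root-unique : ∀ {a b u w} → Nondegenerate a b → + p ∣ a * u + b → + p ∣ a * w + b → u ≈ w
  root-unique {a} {b} {u} {w} nondegenerate p∣au+b p∣aw+b =
    [ (λ p∣a → contradiction (p∣a , p∣b p∣a) nondegenerate) , ⟨_⟩ ]′ (∣*⇒∣⊎∣ a (u - w) p∣a[u-w])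
    where
    difference : ∀ a b u w → (a * u + b) - (a * w + b) ≡ a * (u - w)
    difference = solve-∀
    intercept : ∀ a b u → (a * u + b) - u * a ≡ b
    intercept = solve-∀
    p∣a[u-w] : + p ∣ a * (u - w)
    p∣a[u-w] = ∣-resp-≡ (difference a b u w) (∣m∣n⇒∣m-n p∣au+b p∣aw+b)
    p∣b : + p ∣ a → + p ∣ b
    p∣b p∣a = ∣-resp-≡ (intercept a b u) (∣m∣n⇒∣m-n p∣au+b (∣n⇒∣m*n u p∣a))

record Form : Set where
  constructor form
  field
    c₀ c₁ c₂ c₃ : ℤ

infixl 6 _⊕_
infixr 7 _⊛_

_⊕_ : Form → Form → Form
form a b c d ⊕ form a′ b′ c′ d′ = form (a + a′) (b + b′) (c + c′) (d + d′)

_⊛_ : ℤ → Form → Form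
k ⊛ form a b c d = form (k * a) (k * b) (k * c) (k * d)

module Evaluation (x₀ x₁ x₂ x₃ : ℤ) where

  ⟦_⟧ : Form → ℤ
  ⟦ form a b c d ⟧ = a * x₀ + b * x₁ + c * x₂ + d * x₃

  ⟦⟧-⊕ : ∀ f g → ⟦ f ⊕ g ⟧ ≡ ⟦ f ⟧ + ⟦ g ⟧
  ⟦⟧-⊕ (form a b c d) (form a′ b′ c′ d′) = additive a b c d a′ b′ c′ d′ x₀ x₁ x₂ x₃
    where
    additive : ∀ a b c d a′ b′ c′ d′ x₀ x₁ x₂ x₃ →
      (a + a′) * x₀ + (b + b′) * x₁ + (c + c′) * x₂ + (d + d′) * x₃ ≡
      (a * x₀ + b * x₁ + c * x₂ + d * x₃) + (a′ * x₀ + b′ * x₁ + c′ * x₂ + d′ * x₃)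
    additive = solve-∀

  ⟦⟧-⊛ : ∀ k f → ⟦ k ⊛ f ⟧ ≡ k * ⟦ f ⟧
  ⟦⟧-⊛ k (form a b c d) = homogeneous k a b c d x₀ x₁ x₂ x₃
    where
    homogeneous : ∀ k a b c d x₀ x₁ x₂ x₃ →
      k * a * x₀ + k * b * x₁ + k * c * x₂ + k * d * x₃ ≡ k * (a * x₀ + b * x₁ + c * x₂ + d * x₃)
    homogeneous = solve-∀

  ⟦⟧-unit₀ : ⟦ form 1 0 0 0 ⟧ ≡ x₀
  ⟦⟧-unit₀ = unit x₀ x₁ x₂ x₃
    where
    unit : ∀ x₀ x₁ x₂ x₃ → 1 * x₀ + 0 * x₁ + 0 * x₂ + 0 * x₃ ≡ x₀
    unit = solve-∀

  ⟦⟧-unit₁ : ⟦ form 0 1 0 0 ⟧ ≡ x₁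
  ⟦⟧-unit₁ = unit x₀ x₁ x₂ x₃
    where
    unit : ∀ x₀ x₁ x₂ x₃ → 0 * x₀ + 1 * x₁ + 0 * x₂ + 0 * x₃ ≡ x₁
    unit = solve-∀

  ⟦⟧-unit₂ : ⟦ form 0 0 1 0 ⟧ ≡ x₂
  ⟦⟧-unit₂ = unit x₀ x₁ x₂ x₃
    where
    unit : ∀ x₀ x₁ x₂ x₃ → 0 * x₀ + 0 * x₁ + 1 * x₂ + 0 * x₃ ≡ x₂
    unit = solve-∀

  ⟦⟧-scaled₃ : ∀ c → ⟦ form 0 0 0 c ⟧ ≡ c * x₃
  ⟦⟧-scaled₃ c = scaled c x₀ x₁ x₂ x₃
    where
    scaled : ∀ c x₀ x₁ x₂ x₃ → 0 * x₀ + 0 * x₁ + 0 * x₂ + c * x₃ ≡ c * x₃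
    scaled = solve-∀

  ⟦⟧-linear : ∀ α f β g → ⟦ α ⊛ f ⊕ β ⊛ g ⟧ ≡ α * ⟦ f ⟧ + β * ⟦ g ⟧
  ⟦⟧-linear α f β g = trans (⟦⟧-⊕ (α ⊛ f) (β ⊛ g)) (cong₂ _+_ (⟦⟧-⊛ α f) (⟦⟧-⊛ β g))

module Grid (p : ℕ) .{{_ : NonZero p}} (prime : Prime p) (p∤12 : ¬ p ℕD.∣ 12)
            (v : Fin 4 → Fin 4 → ℤ)
            (rows : ∀ c → Modular.AffineAlong p v 0 c)
            (diagonals : ∀ c → Modular.AffineAlong p v 1 c)
            (antidiagonal : ∃ λ e → Modular.AffineAlongExcept p v e -1 3) where
  open Signed using (_∣_)
  open Modular p
  open PrimeModulus p prime

  -- Values are represented mod p by Forms over the basis v₀₀, v₁₀, v₀₁, E; every cell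
  -- below gets a form (1 - k - l) k l d, i.e. the affine interpolation plus d·E.
  E : ℤ
  E = v 1F 1F - v 1F 0F - v 0F 1F + v 0F 0F

  open Evaluation (v 0F 0F) (v 1F 0F) (v 0F 1F) E

  infix 4 _∼_
  record _∼_ (x : ℤ) (f : Form) : Set where
    constructor represents
    field
      ≈⟦⟧ : x ≈ ⟦ f ⟧

  collinear-along : ∀ {σ c} → AffineAlong v σ c → ∀ k₁ l₁ k₂ l₂ k₃ l₃ →
    + toℕ l₁ ≡ σ * + toℕ k₁ + c → + toℕ l₂ ≡ σ * + toℕ k₂ + c → + toℕ l₃ ≡ σ * + toℕ k₃ + c →
    Collinear (+ toℕ k₁) (+ toℕ k₂) (+ toℕ k₃) (v k₁ l₁) (v k₂ l₂) (v k₃ l₃)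
  collinear-along line k₁ l₁ k₂ l₂ k₃ l₃ on₁ on₂ on₃ =
    collinear slope intercept (+ toℕ k₁) (+ toℕ k₂) (+ toℕ k₃)
      (agrees k₁ l₁ on₁) (agrees k₂ l₂ on₂) (agrees k₃ l₃ on₃)
    where open AffineAlong line

  row : ∀ l k₁ k₂ k₃ → Collinear (+ toℕ k₁) (+ toℕ k₂) (+ toℕ k₃) (v k₁ l) (v k₂ l) (v k₃ l)
  row l k₁ k₂ k₃ = collinear-along (rows (+ toℕ l)) k₁ l k₂ l k₃ l refl refl refl

  extendʳ : ∀ {x y z f g} → Collinear 0 1 2 x y z → x ∼ f → y ∼ g → z ∼ 2 ⊛ g ⊕ -1 ⊛ f
  extendʳ {x} {y} {z} {f} {g} xyz (represents x≈f) (represents y≈g) = represents (begin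
    z                          ≡⟨ isolate x z ⟩
    (1 * x + 1 * z) + -1 * x   ≈⟨ +-cong xyz (*-congˡ -1 x≈f) ⟩
    2 * y + -1 * ⟦ f ⟧         ≈⟨ +-congʳ (-1 * ⟦ f ⟧) (*-congˡ 2 y≈g) ⟩
    2 * ⟦ g ⟧ + -1 * ⟦ f ⟧     ≡⟨ ⟦⟧-linear 2 g -1 f ⟨
    ⟦ 2 ⊛ g ⊕ -1 ⊛ f ⟧         ∎)
    where
    open SetoidReasoning ≈-setoid
    isolate : ∀ x z → z ≡ (1 * x + 1 * z) + -1 * x
    isolate = solve-∀

  extendˡ : ∀ {x y z g h} → Collinear 0 1 2 x y z → y ∼ g → z ∼ h → x ∼ 2 ⊛ g ⊕ -1 ⊛ h
  extendˡ {x} {y} {z} {g} {h} xyz y∼g z∼h =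
    extendʳ {z} {y} {x} {h} {g} (≈-trans (≈-reflexive (ℤP.+-comm (1 * z) (1 * x))) xyz) z∼h y∼g

  collinear-along-except : ∀ {e σ c} → AffineAlongExcept v e σ c → ∀ k₁ l₁ k₂ l₂ k₃ l₃ →
    + toℕ l₁ ≡ σ * + toℕ k₁ + c → + toℕ l₂ ≡ σ * + toℕ k₂ + c → + toℕ l₃ ≡ σ * + toℕ k₃ + c →
    k₁ ≢ e → k₂ ≢ e → k₃ ≢ e →
    Collinear (+ toℕ k₁) (+ toℕ k₂) (+ toℕ k₃) (v k₁ l₁) (v k₂ l₂) (v k₃ l₃)
  collinear-along-except line k₁ l₁ k₂ l₂ k₃ l₃ on₁ on₂ on₃ k₁≢e k₂≢e k₃≢e =
    collinear slope intercept (+ toℕ k₁) (+ toℕ k₂) (+ toℕ k₃)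
      (agrees k₁ l₁ on₁ k₁≢e) (agrees k₂ l₂ on₂ k₂≢e) (agrees k₃ l₃ on₃ k₃≢e)
    where open AffineAlongExcept line

  collinear-∼ : ∀ u v w {x y z f g h} → Collinear u v w x y z → x ∼ f → y ∼ g → z ∼ h →
                ⟦ (w - v) ⊛ f ⊕ (v - u) ⊛ h ⊕ (u - w) ⊛ g ⟧ ≈ 0
  collinear-∼ u v w {x} {y} {z} {f} {g} {h} xyz (represents x≈f) (represents y≈g) (represents z≈h) =
    begin
      ⟦ (w - v) ⊛ f ⊕ (v - u) ⊛ h ⊕ (u - w) ⊛ g ⟧
        ≡⟨ ⟦⟧-⊕ ((w - v) ⊛ f ⊕ (v - u) ⊛ h) ((u - w) ⊛ g) ⟩
      ⟦ (w - v) ⊛ f ⊕ (v - u) ⊛ h ⟧ + ⟦ (u - w) ⊛ g ⟧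
        ≡⟨ cong₂ _+_ (⟦⟧-linear (w - v) f (v - u) h) (⟦⟧-⊛ (u - w) g) ⟩
      (w - v) * ⟦ f ⟧ + (v - u) * ⟦ h ⟧ + (u - w) * ⟦ g ⟧
        ≈⟨ +-cong (+-cong (*-congˡ (w - v) x≈f) (*-congˡ (v - u) z≈h)) (*-congˡ (u - w) y≈g) ⟨
      (w - v) * x + (v - u) * z + (u - w) * y
        ≈⟨ +-congʳ ((u - w) * y) xyz ⟩
      (w - u) * y + (u - w) * y
        ≡⟨ cancel u w y ⟩
      0
    ∎
    where
    open SetoidReasoning ≈-setoid
    cancel : ∀ u w y → (w - u) * y + (u - w) * y ≡ 0
    cancel = solve-∀

  v₀₀ : v 0F 0F ∼ form 1 0 0 0
  v₀₀ = represents (≈-reflexive (sym ⟦⟧-unit₀))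

  v₁₀ : v 1F 0F ∼ form 0 1 0 0
  v₁₀ = represents (≈-reflexive (sym ⟦⟧-unit₁))

  v₀₁ : v 0F 1F ∼ form 0 0 1 0
  v₀₁ = represents (≈-reflexive (sym ⟦⟧-unit₂))

  v₁₁ : v 1F 1F ∼ form -1 1 1 1
  v₁₁ = represents (≈-reflexive (unfold-E (v 0F 0F) (v 1F 0F) (v 0F 1F) (v 1F 1F)))
    where
    unfold-E : ∀ x₀₀ x₁₀ x₀₁ x₁₁ → x₁₁ ≡ -1 * x₀₀ + 1 * x₁₀ + 1 * x₀₁ + 1 * (x₁₁ - x₁₀ - x₀₁ + x₀₀)
    unfold-E = solve-∀

  v₂₀ : v 2F 0F ∼ form -1 2 0 0
  v₂₀ = extendʳ (row 0F 0F 1F 2F) v₀₀ v₁₀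

  v₃₀ : v 3F 0F ∼ form -2 3 0 0
  v₃₀ = extendʳ (row 0F 1F 2F 3F) v₁₀ v₂₀

  v₂₁ : v 2F 1F ∼ form -2 2 1 2
  v₂₁ = extendʳ (row 1F 0F 1F 2F) v₀₁ v₁₁

  v₃₁ : v 3F 1F ∼ form -3 3 1 3
  v₃₁ = extendʳ (row 1F 1F 2F 3F) v₁₁ v₂₁

  v₂₂ : v 2F 2F ∼ form -3 2 2 2
  v₂₂ = extendʳ (collinear-along (diagonals 0) 0F 0F 1F 1F 2F 2F refl refl refl) v₀₀ v₁₁

  v₃₃ : v 3F 3F ∼ form -5 3 3 3
  v₃₃ = extendʳ (collinear-along (diagonals 0) 1F 1F 2F 2F 3F 3F refl refl refl) v₁₁ v₂₂

  v₃₂ : v 3F 2F ∼ form -4 3 2 4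
  v₃₂ = extendʳ (collinear-along (diagonals -1) 1F 0F 2F 1F 3F 2F refl refl refl) v₁₀ v₂₁

  v₁₂ : v 1F 2F ∼ form -2 1 2 0
  v₁₂ = extendˡ (row 2F 1F 2F 3F) v₂₂ v₃₂

  v₀₂ : v 0F 2F ∼ form -1 0 2 -2
  v₀₂ = extendˡ (row 2F 0F 1F 2F) v₁₂ v₂₂

  v₂₃ : v 2F 3F ∼ form -4 2 3 0
  v₂₃ = extendʳ (collinear-along (diagonals 1) 0F 1F 1F 2F 2F 3F refl refl refl) v₀₁ v₁₂

  v₁₃ : v 1F 3F ∼ form -3 1 3 -3
  v₁₃ = extendˡ (row 3F 1F 2F 3F) v₂₃ v₃₃

  v₀₃ : v 0F 3F ∼ form -2 0 3 -6
  v₀₃ = extendˡ (row 3F 0F 1F 2F) v₁₃ v₂₃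

  E-vanishes : ∀ c → ¬ + p ∣ c → ⟦ form 0 0 0 c ⟧ ≈ 0 → + p ∣ E
  E-vanishes c p∤c c·E≈0 = ∣*-cancelˡ p∤c (∣-resp-≡ (⟦⟧-scaled₃ c) (≈0⇒∣ c·E≈0))

  p∤-12 : ¬ + p ∣ -12
  p∤-12 p∣-12 = p∤12 (∣⇒∣ᵤ p∣-12)

  p∤-4 : ¬ + p ∣ -4
  p∤-4 p∣-4 = p∤12 (ℕD.∣-trans (∣⇒∣ᵤ p∣-4) (ℕD.divides 3 refl))

  p∣E : + p ∣ E
  p∣E = from-antidiagonal antidiagonal
    where
    from-antidiagonal : ∃ (λ e → AffineAlongExcept v e -1 3) → + p ∣ E
    from-antidiagonal (0F , line) = E-vanishes -4 p∤-4
      (collinear-∼ 1 2 3 (collinear-along-except line 1F 2F 2F 1F 3F 0F refl refl refl (λ ()) (λ ()) (λ ()))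
         v₁₂ v₂₁ v₃₀)
    from-antidiagonal (1F , line) = E-vanishes -12 p∤-12
      (collinear-∼ 0 2 3 (collinear-along-except line 0F 3F 2F 1F 3F 0F refl refl refl (λ ()) (λ ()) (λ ()))
         v₀₃ v₂₁ v₃₀)
    from-antidiagonal (2F , line) = E-vanishes -12 p∤-12
      (collinear-∼ 0 1 3 (collinear-along-except line 0F 3F 1F 2F 3F 0F refl refl refl (λ ()) (λ ()) (λ ()))
         v₀₃ v₁₂ v₃₀)
    from-antidiagonal (3F , line) = E-vanishes -4 p∤-4
      (collinear-∼ 0 1 2 (collinear-along-except line 0F 3F 1F 2F 2F 1F refl refl refl (λ ()) (λ ()) (λ ()))
         v₀₃ v₁₂ v₂₁)

  A B C : ℤ
  A = v 1F 0F - v 0F 0F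
  B = v 0F 1F - v 0F 0F
  C = v 0F 0F

  affine-cell : ∀ {x k l d} → x ∼ form (1 - k - l) k l d → x ≈ A * k + B * l + C
  affine-cell {x} {k} {l} {d} (represents x≈) = begin
    x                           ≈⟨ x≈ ⟩
    ⟦ form (1 - k - l) k l d ⟧  ≡⟨ separate (v 0F 0F) (v 1F 0F) (v 0F 1F) (v 1F 1F) k l d ⟩
    A * k + B * l + C + d * E   ≈⟨ +-congˡ (A * k + B * l + C) (∣⇒≈0 (∣n⇒∣m*n d p∣E)) ⟩
    A * k + B * l + C + 0       ≡⟨ ℤP.+-identityʳ _ ⟩
    A * k + B * l + C           ∎
    where
    open SetoidReasoning ≈-setoid
    separate : ∀ x₀₀ x₁₀ x₀₁ x₁₁ k l d → let E = x₁₁ - x₁₀ - x₀₁ + x₀₀ in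
      (1 - k - l) * x₀₀ + k * x₁₀ + l * x₀₁ + d * E ≡ (x₁₀ - x₀₀) * k + (x₀₁ - x₀₀) * l + x₀₀ + d * E
    separate = solve-∀

  grid-affine : ∀ k l → v k l ≈ A * + toℕ k + B * + toℕ l + C
  grid-affine 0F 0F = affine-cell v₀₀
  grid-affine 0F 1F = affine-cell v₀₁
  grid-affine 0F 2F = affine-cell v₀₂
  grid-affine 0F 3F = affine-cell v₀₃
  grid-affine 1F 0F = affine-cell v₁₀
  grid-affine 1F 1F = affine-cell v₁₁
  grid-affine 1F 2F = affine-cell v₁₂
  grid-affine 1F 3F = affine-cell v₁₃
  grid-affine 2F 0F = affine-cell v₂₀
  grid-affine 2F 1F = affine-cell v₂₁
  grid-affine 2F 2F = affine-cell v₂₂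
  grid-affine 2F 3F = affine-cell v₂₃
  grid-affine 3F 0F = affine-cell v₃₀
  grid-affine 3F 1F = affine-cell v₃₁
  grid-affine 3F 2F = affine-cell v₃₂
  grid-affine 3F 3F = affine-cell v₃₃

module Counting (p : ℕ) .{{_ : NonZero p}} (prime : Prime p)
                (slope intercept : ℤ → ℤ → ℤ)
                (nondegenerate : ∀ j i → Modular.Nondegenerate p (slope j i) (intercept j i)) where
  open Signed using (_∣_)
  open Modular p
  open PrimeModulus p prime

  Vanishes : ℤ → ℤ → ℕ → Set
  Vanishes j i n = + p ∣ slope j i * + n + intercept j i

  vanishes-unique : ∀ {j i m n} → Vanishes j i m → Vanishes j i n → m ℕ./ p ≡ n ℕ./ p → m ≡ n
  vanishes-unique {j} {i} vm vn same-quotient =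
    ≈-and-same-quotient⇒≡ same-quotient (root-unique (nondegenerate j i) vm vn)

  vanishes-nearby⇒≡ : ∀ {j i n₀ a b} → a ℕ.< p → b ℕ.< p →
                      Vanishes j i (n₀ ℕ.+ a) → Vanishes j i (n₀ ℕ.+ b) → a ≡ b
  vanishes-nearby⇒≡ {j} {i} {n₀} {a} {b} a<p b<p va vb =
    ≈-residue⇒≡ a<p b<p ⟨ ∣-resp-≡ shift (∣difference (root-unique (nondegenerate j i) va vb)) ⟩
    where
    drop : ∀ n a b → n + a - (n + b) ≡ a - b
    drop = solve-∀
    shift : + (n₀ ℕ.+ a) - + (n₀ ℕ.+ b) ≡ + a - + b
    shift = trans (cong₂ _-_ (ℤP.pos-+ n₀ a) (ℤP.pos-+ n₀ b)) (drop (+ n₀) (+ a) (+ b))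

  VanishesThrough : ℤ → ℕ → ℕ → Set
  VanishesThrough σ n m = Vanishes σ (+ m - σ * + n) n

  Bad : ℕ → ℕ → Set
  Bad n m = VanishesThrough 0 n m ⊎ VanishesThrough 1 n m

  bad? : ∀ n m → Dec (Bad n m)
  bad? n m = (+ p ∣? _) ⊎-dec (+ p ∣? _)

  Column : Set
  Column = Fin (p ℕ.* 4)

  block : Column → Fin 4
  block n = fromℕ< (ℕDivMod.m<n*o⇒m/o<n (subst (toℕ n ℕ.<_) (ℕP.*-comm p 4) (FinP.toℕ<n n)))

  diagonal : Column → Column → Fin (p ℕ.* 8)
  diagonal n m = fromℕ< {toℕ m ℕ.+ p ℕ.* 4 ℕ.∸ toℕ n} (begin-strict
    toℕ m ℕ.+ p ℕ.* 4 ℕ.∸ toℕ n   ≤⟨ ℕP.m∸n≤m _ (toℕ n) ⟩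
    toℕ m ℕ.+ p ℕ.* 4            <⟨ ℕP.+-monoˡ-< (p ℕ.* 4) (FinP.toℕ<n m) ⟩
    p ℕ.* 4 ℕ.+ p ℕ.* 4          ≡⟨ ℕP.*-distribˡ-+ p 4 4 ⟨
    p ℕ.* 8                      ∎)
    where open ℕP.≤-Reasoning

  diagonal-intercept : ∀ n m → + toℕ m - 1 * + toℕ n ≡ + toℕ (diagonal n m) - + (p ℕ.* 4)
  diagonal-intercept n m = begin
    + toℕ m - 1 * + toℕ n                              ≡⟨ shift (+ toℕ m) (+ toℕ n) (+ (p ℕ.* 4)) ⟩
    (+ toℕ m + + (p ℕ.* 4)) - + toℕ n - + (p ℕ.* 4)    ≡⟨ cong (λ k → k - + toℕ n - + (p ℕ.* 4)) m+4p ⟨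
    + (toℕ m ℕ.+ p ℕ.* 4) - + toℕ n - + (p ℕ.* 4)      ≡⟨ cong (λ k → k - + (p ℕ.* 4)) index ⟨
    + toℕ (diagonal n m) - + (p ℕ.* 4)                 ∎
    where
    open ≡-Reasoning
    shift : ∀ m n c → m - 1 * n ≡ (m + c) - n - c
    m+4p : + (toℕ m ℕ.+ p ℕ.* 4) ≡ + toℕ m + + (p ℕ.* 4)
    m+4p = ℤP.pos-+ (toℕ m) (p ℕ.* 4)
    shift = solve-∀
    n≤m+4p : toℕ n ℕ.≤ toℕ m ℕ.+ p ℕ.* 4
    n≤m+4p = ℕP.≤-trans (ℕP.<⇒≤ (FinP.toℕ<n n)) (ℕP.m≤n+m (p ℕ.* 4) (toℕ m))
    index : + toℕ (diagonal n m) ≡ + (toℕ m ℕ.+ p ℕ.* 4) - + toℕ n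
    index = trans (cong +_ (FinP.toℕ-fromℕ< _))
                  (sym (trans (ℤP.m-n≡m⊖n _ (toℕ n)) (ℤP.⊖-≥ n≤m+4p)))

  same-block⇒same-quotient : ∀ {n n′} → block n ≡ block n′ → toℕ n ℕ./ p ≡ toℕ n′ ℕ./ p
  same-block⇒same-quotient {n} {n′} eq =
    trans (sym (FinP.toℕ-fromℕ< _)) (trans (cong toℕ eq) (FinP.toℕ-fromℕ< _))

  -- A bad cell is keyed by its line (row m < 4p, or diagonal m + 4p ∸ n < 8p, where ∸ never
  -- truncates) and by the block n / p < 4 of its column.  A nondegenerate line vanishes at
  -- most once per block, so the key determines the cell.
  key-count : ℕ
  key-count = p ℕ.* 4 ℕ.* 4 ℕ.+ p ℕ.* 8 ℕ.* 4

  key : ∀ n m → Bad (toℕ n) (toℕ m) → Fin key-count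
  key n m (inj₁ _) = join _ _ (inj₁ (combine m (block n)))
  key n m (inj₂ _) = join _ _ (inj₂ (combine (diagonal n m) (block n)))

  join-injective : ∀ a b {x y : Fin a ⊎ Fin b} → join a b x ≡ join a b y → x ≡ y
  join-injective a b {x} {y} eq =
    trans (sym (FinP.splitAt-join a b x)) (trans (cong (splitAt a) eq) (FinP.splitAt-join a b y))

  key-injective : ∀ {n m n′ m′} (b : Bad (toℕ n) (toℕ m)) (b′ : Bad (toℕ n′) (toℕ m′)) →
                  key n m b ≡ key n′ m′ b′ → n ≡ n′ × m ≡ m′
  key-injective {n} {m} {n′} {m′} (inj₁ vanishes) (inj₁ vanishes′) eq
    with FinP.combine-injective m (block n) m′ (block n′) (inj₁-injective (join-injective _ _ eq))
  ... | refl , same-block =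
    FinP.toℕ-injective (vanishes-unique vanishes vanishes′ (same-block⇒same-quotient same-block)) , refl
  key-injective {n} {m} {n′} {m′} (inj₁ _) (inj₂ _) eq
    with join-injective _ _ {inj₁ (combine m (block n))} {inj₂ (combine (diagonal n′ m′) (block n′))} eq
  ... | ()
  key-injective {n} {m} {n′} {m′} (inj₂ _) (inj₁ _) eq
    with join-injective _ _ {inj₂ (combine (diagonal n m) (block n))} {inj₁ (combine m′ (block n′))} eq
  ... | ()
  key-injective {n} {m} {n′} {m′} (inj₂ vanishes) (inj₂ vanishes′) eq
    with FinP.combine-injective (diagonal n m) (block n) (diagonal n′ m′) (block n′)
           (inj₂-injective (join-injective _ _ eq))
  ... | same-diagonal , same-block =
    n≡n′ , FinP.toℕ-injective (ℤP.+-injective (minus-cancelʳ {c = 1 * + toℕ n′} same-line′))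
    where
    same-line : + toℕ m - 1 * + toℕ n ≡ + toℕ m′ - 1 * + toℕ n′
    same-line = trans (diagonal-intercept n m)
      (trans (cong (λ d → + toℕ d - + (p ℕ.* 4)) same-diagonal) (sym (diagonal-intercept n′ m′)))
    n≡n′ : n ≡ n′
    n≡n′ = FinP.toℕ-injective
      (vanishes-unique (subst (λ i → Vanishes 1 i (toℕ n)) same-line vanishes) vanishes′
        (same-block⇒same-quotient same-block))
    same-line′ : + toℕ m - 1 * + toℕ n′ ≡ + toℕ m′ - 1 * + toℕ n′
    same-line′ = subst (λ k → + toℕ m - 1 * + toℕ k ≡ + toℕ m′ - 1 * + toℕ n′) n≡n′ same-line

  BadCellIn : Fin p → Fin p → Set
  BadCellIn s t = ∃₂ λ (k l : Fin 4) → Bad (toℕ (combine s k)) (toℕ (combine t l))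

  bad-cell-in? : ∀ s t → Dec (BadCellIn s t)
  bad-cell-in? s t = FinP.any? λ k → FinP.any? λ l → bad? _ _

  cell-key : ∀ {s t} → BadCellIn s t → Fin key-count
  cell-key {s} {t} (k , l , bad) = key (combine s k) (combine t l) bad

  cell-key-injective : ∀ {s t s′ t′} (c : BadCellIn s t) (c′ : BadCellIn s′ t′) →
                       cell-key c ≡ cell-key c′ → (s , t) ≡ (s′ , t′)
  cell-key-injective {s} {t} {s′} {t′} (k , l , bad) (k′ , l′ , bad′) eq with key-injective bad bad′ eq
  ... | same-column , same-row with FinP.combine-injective s k s′ k′ same-column
                                  | FinP.combine-injective t l t′ l′ same-row
  ...   | refl , _ | refl , _ = refl

  key-count<p*p : 48 ℕ.< p → key-count ℕ.< p ℕ.* p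
  key-count<p*p 48<p = begin-strict
    p ℕ.* 4 ℕ.* 4 ℕ.+ p ℕ.* 8 ℕ.* 4   ≡⟨ cong₂ ℕ._+_ (ℕP.*-assoc p 4 4) (ℕP.*-assoc p 8 4) ⟩
    p ℕ.* 16 ℕ.+ p ℕ.* 32             ≡⟨ ℕP.*-distribˡ-+ p 16 32 ⟨
    p ℕ.* 48                          <⟨ ℕP.*-monoʳ-< p 48<p ⟩
    p ℕ.* p                           ∎
    where open ℕP.≤-Reasoning

  good-square : 48 ℕ.< p → ∃₂ λ s t → ¬ BadCellIn s t
  good-square 48<p with FinP.any? (λ s → FinP.any? λ t → ¬? (bad-cell-in? s t))
  ... | yes (s , t , good) = s , t , good
  ... | no no-good-square = contradiction (FinP.injective⇒≤ square-key-injective) (ℕP.<⇒≱ (key-count<p*p 48<p))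
    where
    bad-cell : ∀ s t → BadCellIn s t
    bad-cell s t = decidable-stable (bad-cell-in? s t) (λ good → no-good-square (s , t , good))
    square-key : Fin (p ℕ.* p) → Fin key-count
    square-key x = cell-key (bad-cell (proj₁ (remQuot {p} p x)) (proj₂ (remQuot {p} p x)))
    square-key-injective : Injective _≡_ _≡_ square-key
    square-key-injective {x} {y} eq = begin
      x                                  ≡⟨ FinP.combine-remQuot {p} p x ⟨
      uncurry combine (remQuot {p} p x)  ≡⟨ cong (uncurry combine) same-square ⟩
      uncurry combine (remQuot {p} p y)  ≡⟨ FinP.combine-remQuot {p} p y ⟩
      y                                  ∎
      where
      open ≡-Reasoning
      same-square : remQuot {p} p x ≡ remQuot {p} p y
      same-square = cell-key-injective (bad-cell _ _) (bad-cell _ _) eq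

window-offset : ∀ {a b} r → a ℕ.≤ b → b ℕ.≤ a ℕ.+ r → ∃ λ (k : Fin (suc r)) → b ≡ a ℕ.+ toℕ k
window-offset {a} {b} r a≤b b≤a+r = fromℕ< (s≤s b∸a≤r) , (begin
  b                  ≡⟨ ℕP.m+[n∸m]≡n a≤b ⟨
  a ℕ.+ (b ℕ.∸ a)    ≡⟨ cong (a ℕ.+_) (FinP.toℕ-fromℕ< (s≤s b∸a≤r)) ⟨
  a ℕ.+ toℕ (fromℕ< (s≤s b∸a≤r)) ∎)
  where
  open ≡-Reasoning
  b∸a≤r : b ℕ.∸ a ℕ.≤ r
  b∸a≤r = subst (b ℕ.∸ a ℕ.≤_) (ℕP.m+n∸m≡n a r) (ℕP.∸-monoˡ-≤ a b≤a+r)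

window-offsetℤ : ∀ {a m} r → + a ℤ.≤ m → m ℤ.≤ + a + + r → ∃ λ (l : Fin (suc r)) → m ≡ + (a ℕ.+ toℕ l)
window-offsetℤ {a} {+ b} r (ℤ.+≤+ a≤b) (ℤ.+≤+ b≤a+r) with window-offset r a≤b b≤a+r
... | l , b≡a+l = l , cong +_ b≡a+l

module Solution (p N : ℕ) .{{_ : NonZero p}} (prime : Prime p)
                (F : Fin N → ℤ → Units p) (sol : IsSudokuSolution p N F) where
  open Signed using (_∣_)
  open Modular p
  open PrimeModulus p prime

  slope intercept : ℤ → ℤ → ℤ
  slope j i = proj₁ (sol j i)
  intercept j i = proj₁ (proj₂ (sol j i))

  nondegenerate : ∀ j i → Nondegenerate (slope j i) (intercept j i)
  nondegenerate j i (p∣a , p∣b) = proj₁ (proj₂ (proj₂ (sol j i))) (∣⇒∣ᵤ p∣a , ∣⇒∣ᵤ p∣b)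

  open Counting p prime slope intercept nondegenerate public

  value : Fin N → ℤ → ℤ
  value n m = + toℕ (proj₁ (F n m))

  value-on-line : ∀ j i (n : Fin N) m → m ≡ j * + toℕ n + i → ¬ Vanishes j i (toℕ n) →
                  value n m ≈ slope j i * + toℕ n + intercept j i
  value-on-line j i n m refl p∤x =
    subst (λ u → + toℕ u ≈ x) (sym (IsFp⇒≡π p∤x (proj₂ (proj₂ (proj₂ (sol j i))) n p²∤x))) (toℕ-π≈ x)
    where
    x : ℤ
    x = slope j i * + toℕ n + intercept j i
    p²∤x : ν≤1 p x
    p²∤x p²∣x = p∤x (∣ᵤ⇒∣ (ℕD.∣-trans (ℕD.m∣m*n p) p²∣x))

  value-residue : ∀ n m {y} → value n m ≈ y → proj₁ (F n m) ≡ π p y × ν≡0 p y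
  value-residue n m {y} v≈y = toℕ≈⇒≡π u y v≈y , λ p∣y → proj₂ (F n m)
    (∣-small⇒≡0 (FinP.toℕ<n u) (∣⇒∣ᵤ (≈0⇒∣ (≈-trans v≈y (∣⇒≈0 (∣ᵤ⇒∣ p∣y))))))
    where
    u : Fin p
    u = proj₁ (F n m)

  good-window : 48 ℕ.< p → p ℕ.* p ℕ.≤ N →
    ∃₂ λ n₀ m₀ → n₀ ℕ.+ 3 ℕ.< N × ∀ (k l : Fin 4) → ¬ Bad (n₀ ℕ.+ toℕ k) (m₀ ℕ.+ toℕ l)
  good-window 48<p p*p≤N with good-square 48<p
  ... | s , t , no-bad-cell = 4 ℕ.* toℕ s , 4 ℕ.* toℕ t , n₀+3<N , good
    where
    n₀+3<N : 4 ℕ.* toℕ s ℕ.+ 3 ℕ.< N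
    n₀+3<N = begin-strict
      4 ℕ.* toℕ s ℕ.+ 3  ≡⟨ FinP.toℕ-combine s 3F ⟨
      toℕ (combine s 3F) <⟨ FinP.toℕ<n (combine s 3F) ⟩
      p ℕ.* 4            ≤⟨ ℕP.*-monoʳ-≤ p (ℕP.≤-trans (ℕP.m≤m+n 4 45) 48<p) ⟩
      p ℕ.* p            ≤⟨ p*p≤N ⟩
      N                  ∎
      where open ℕP.≤-Reasoning
    good : ∀ (k l : Fin 4) → ¬ Bad (4 ℕ.* toℕ s ℕ.+ toℕ k) (4 ℕ.* toℕ t ℕ.+ toℕ l)
    good k l bad =
      no-bad-cell (k , l , subst₂ Bad (sym (FinP.toℕ-combine s k)) (sym (FinP.toℕ-combine t l)) bad)

  module Window (12<p : 12 ℕ.< p) (n₀ m₀ : ℕ) (n₀+3<N : n₀ ℕ.+ 3 ℕ.< N)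
                (good : ∀ (k l : Fin 4) → ¬ Bad (n₀ ℕ.+ toℕ k) (m₀ ℕ.+ toℕ l)) where

    column : Fin 4 → Fin N
    column k = fromℕ< {n₀ ℕ.+ toℕ k} (ℕP.≤-<-trans (ℕP.+-monoʳ-≤ n₀ (FinP.toℕ≤pred[n] k)) n₀+3<N)

    toℕ-column : ∀ k → toℕ (column k) ≡ n₀ ℕ.+ toℕ k
    toℕ-column k = FinP.toℕ-fromℕ< _

    v : Fin 4 → Fin 4 → ℤ
    v k l = value (column k) (+ (m₀ ℕ.+ toℕ l))

    board-intercept : ℤ → ℤ → ℤ
    board-intercept σ c = + m₀ - σ * + n₀ + c

    window-slope window-intercept : ℤ → ℤ → ℤ
    window-slope σ c = slope σ (board-intercept σ c)
    window-intercept σ c = window-slope σ c * + n₀ + intercept σ (board-intercept σ c)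

    on-board-line : ∀ σ c (k l : Fin 4) → + toℕ l ≡ σ * + toℕ k + c →
                    + (m₀ ℕ.+ toℕ l) ≡ σ * + (n₀ ℕ.+ toℕ k) + board-intercept σ c
    on-board-line σ c k l on = begin
      + (m₀ ℕ.+ toℕ l)                               ≡⟨ ℤP.pos-+ m₀ (toℕ l) ⟩
      + m₀ + + toℕ l                                 ≡⟨ cong (λ x → + m₀ + x) on ⟩
      + m₀ + (σ * + toℕ k + c)                       ≡⟨ shift (+ m₀) (+ n₀) (+ toℕ k) σ c ⟩
      σ * (+ n₀ + + toℕ k) + board-intercept σ c     ≡⟨ cong (λ n → σ * n + board-intercept σ c) (ℤP.pos-+ n₀ (toℕ k)) ⟨
      σ * + (n₀ ℕ.+ toℕ k) + board-intercept σ c     ∎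
      where
      open ≡-Reasoning
      shift : ∀ m n k σ c → m + (σ * k + c) ≡ σ * (n + k) + (m - σ * n + c)
      shift = solve-∀

    affine-where-nonvanishing : ∀ σ c (k l : Fin 4) → + toℕ l ≡ σ * + toℕ k + c →
      ¬ Vanishes σ (board-intercept σ c) (n₀ ℕ.+ toℕ k) →
      v k l ≈ window-slope σ c * + toℕ k + window-intercept σ c
    affine-where-nonvanishing σ c k l on nonvanishing = begin
      v k l                    ≈⟨ value-on-line σ i (column k) _ on-line nonvanishing′ ⟩
      a * + toℕ (column k) + b ≡⟨ cong (λ n → a * + n + b) (toℕ-column k) ⟩
      a * + (n₀ ℕ.+ toℕ k) + b ≡⟨ cong (λ n → a * n + b) (ℤP.pos-+ n₀ (toℕ k)) ⟩
      a * (+ n₀ + + toℕ k) + b ≡⟨ regroup a (+ n₀) (+ toℕ k) b ⟩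
      a * + toℕ k + (a * + n₀ + b) ∎
      where
      open SetoidReasoning ≈-setoid
      i a b : ℤ
      i = board-intercept σ c
      a = slope σ i
      b = intercept σ i
      on-line : + (m₀ ℕ.+ toℕ l) ≡ σ * + toℕ (column k) + i
      on-line = subst (λ n → + (m₀ ℕ.+ toℕ l) ≡ σ * + n + i) (sym (toℕ-column k)) (on-board-line σ c k l on)
      nonvanishing′ : ¬ Vanishes σ i (toℕ (column k))
      nonvanishing′ = subst (λ n → ¬ Vanishes σ i n) (sym (toℕ-column k)) nonvanishing
      regroup : ∀ a n k b → a * (n + k) + b ≡ a * k + (a * n + b)
      regroup = solve-∀

    through-intercept : ∀ σ c (k l : Fin 4) → + toℕ l ≡ σ * + toℕ k + c →
                        + (m₀ ℕ.+ toℕ l) - σ * + (n₀ ℕ.+ toℕ k) ≡ board-intercept σ c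
    through-intercept σ c k l on =
      trans (cong (λ x → x - σ * + (n₀ ℕ.+ toℕ k)) (on-board-line σ c k l on))
            (cancel (σ * + (n₀ ℕ.+ toℕ k)) (board-intercept σ c))
      where
      cancel : ∀ x y → x + y - x ≡ y
      cancel = solve-∀

    affine-along : ∀ σ c → (∀ k l → + toℕ l ≡ σ * + toℕ k + c →
                                   ¬ VanishesThrough σ (n₀ ℕ.+ toℕ k) (m₀ ℕ.+ toℕ l)) →
                   AffineAlong v σ c
    affine-along σ c nonvanishing = record
      { slope = window-slope σ c
      ; intercept = window-intercept σ c
      ; agrees = λ k l on → affine-where-nonvanishing σ c k l on
          (subst (λ i → ¬ Vanishes σ i (n₀ ℕ.+ toℕ k)) (through-intercept σ c k l on) (nonvanishing k l on))
      }

    affine-along-except : ∀ {e} σ c → (∀ k → k ≢ e → ¬ Vanishes σ (board-intercept σ c) (n₀ ℕ.+ toℕ k)) →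
                          AffineAlongExcept v e σ c
    affine-along-except σ c nonvanishing = record
      { slope = window-slope σ c
      ; intercept = window-intercept σ c
      ; agrees = λ k l on k≢e → affine-where-nonvanishing σ c k l on (nonvanishing k k≢e) }

    rows : ∀ c → AffineAlong v 0 c
    rows c = affine-along 0 c (λ k l _ bad → good k l (inj₁ bad))

    diagonals : ∀ c → AffineAlong v 1 c
    diagonals c = affine-along 1 c (λ k l _ bad → good k l (inj₂ bad))

    antidiagonal-vanishes-once : ∀ {k e : Fin 4} → Vanishes -1 (board-intercept -1 3) (n₀ ℕ.+ toℕ k) →
                                 Vanishes -1 (board-intercept -1 3) (n₀ ℕ.+ toℕ e) → k ≡ e
    antidiagonal-vanishes-once {k} {e} at-k at-e =
      FinP.toℕ-injective (vanishes-nearby⇒≡ (small k) (small e) at-k at-e)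
      where
      small : ∀ (k : Fin 4) → toℕ k ℕ.< p
      small k = ℕP.≤-<-trans (FinP.toℕ≤pred[n] k) (ℕP.<-trans (ℕP.m<m+n 3 (s≤s z≤n)) 12<p)

    antidiagonal : ∃ λ e → AffineAlongExcept v e -1 3
    antidiagonal
      with FinP.any? (λ k → + p ∣? window-slope -1 3 * + (n₀ ℕ.+ toℕ k) + intercept -1 (board-intercept -1 3))
    ... | yes (e , at-e) =
      e , affine-along-except -1 3 λ k k≢e at-k → k≢e (antidiagonal-vanishes-once at-k at-e)
    ... | no never = 0F , affine-along-except -1 3 λ k _ at-k → never (k , at-k)

    open Grid p prime (ℕD.>⇒∤ 12<p) v rows diagonals antidiagonal
      public using (A; B; C; grid-affine)

    C₀ : ℤ
    C₀ = C - A * + n₀ - B * + m₀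

    window-affine : ∀ (n : Fin N) m → n₀ ℕ.≤ toℕ n → toℕ n ℕ.≤ n₀ ℕ.+ 3 → + m₀ ℤ.≤ m → m ℤ.≤ + m₀ ℤ.+ + 3 →
                    value n m ≈ A * + toℕ n + B * m + C₀
    window-affine n m n₀≤n n≤n₀+3 m₀≤m m≤m₀+3
      with window-offset 3 n₀≤n n≤n₀+3 | window-offsetℤ 3 m₀≤m m≤m₀+3
    ... | k , n≡n₀+k | l , refl = begin
      value n (+ (m₀ ℕ.+ toℕ l))
        ≡⟨ cong (λ n → value n (+ (m₀ ℕ.+ toℕ l))) n≡column ⟩
      v k l
        ≈⟨ grid-affine k l ⟩
      A * + toℕ k + B * + toℕ l + C
        ≡⟨ shift A B C (+ n₀) (+ m₀) (+ toℕ k) (+ toℕ l) ⟩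
      A * (+ n₀ + + toℕ k) + B * (+ m₀ + + toℕ l) + C₀
        ≡⟨ cong₂ (λ x y → A * x + B * y + C₀) (ℤP.pos-+ n₀ (toℕ k)) (ℤP.pos-+ m₀ (toℕ l)) ⟨
      A * + (n₀ ℕ.+ toℕ k) + B * + (m₀ ℕ.+ toℕ l) + C₀
        ≡⟨ cong (λ x → A * + x + B * + (m₀ ℕ.+ toℕ l) + C₀) n≡n₀+k ⟨
      A * + toℕ n + B * + (m₀ ℕ.+ toℕ l) + C₀
      ∎
      where
      open SetoidReasoning ≈-setoid
      n≡column : n ≡ column k
      n≡column = FinP.toℕ-injective (trans n≡n₀+k (sym (toℕ-column k)))
      shift : ∀ A B C n m k l → A * k + B * l + C ≡ A * (n + k) + B * (m + l) + (C - A * n - B * m)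
      shift = solve-∀

    coefficients-nondegenerate : ¬ (+ p ∣ A × + p ∣ B × + p ∣ C₀)
    coefficients-nondegenerate (p∣A , p∣B , p∣C₀) =
      proj₂ (value-residue corner (+ m₀) (window-affine corner (+ m₀) n₀≤corner corner≤n₀+3 ℤP.≤-refl m₀≤m₀+3))
        (∣⇒∣ᵤ (∣m∣n⇒∣m+n (∣m∣n⇒∣m+n (∣m⇒∣m*n _ p∣A) (∣m⇒∣m*n _ p∣B)) p∣C₀))
      where
      corner : Fin N
      corner = column 0F
      n₀≤corner : n₀ ℕ.≤ toℕ corner
      n₀≤corner = subst (n₀ ℕ.≤_) (sym (toℕ-column 0F)) (ℕP.m≤m+n n₀ 0)
      corner≤n₀+3 : toℕ corner ℕ.≤ n₀ ℕ.+ 3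
      corner≤n₀+3 = subst (ℕ._≤ n₀ ℕ.+ 3) (sym (toℕ-column 0F)) (ℕP.+-monoʳ-≤ n₀ z≤n)
      m₀≤m₀+3 : + m₀ ℤ.≤ + m₀ ℤ.+ + 3
      m₀≤m₀+3 = ℤ.+≤+ (ℕP.m≤m+n m₀ 3)

-- The statement's _∣_ is Data.Integer.Divisibility's; the modules above open the signed
-- _∣_ locally, so it is imported only here.
open import Data.Integer.Divisibility using (_∣_)

lemma4p8 : (p : ℕ) .{{_ : NonZero p}} → Prime p → 48 ℕ.< p →
    (N : ℕ) → ℕ.NonZero N → (p ℕ.* p) ℕD.∣ N →
    (F : Fin N → ℤ → Units p) → IsSudokuSolution p N F →
    ∃[ n₀ ] ∃[ m₀ ] ∃[ A ] ∃[ B ] ∃[ C ]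
      (n₀ ℕ.+ 4 ℕ.≤ N
       × ¬ ((+ p) ∣ A × (+ p) ∣ B × (+ p) ∣ C)
       × ((n : Fin N) (m : ℤ) →
           n₀ ℕ.≤ toℕ n → toℕ n ℕ.≤ n₀ ℕ.+ 3 →
           m₀ ℤ.≤ m → m ℤ.≤ m₀ ℤ.+ + 3 →
           (proj₁ (F n m) ≡ π p (A ℤ.* (+ toℕ n) ℤ.+ B ℤ.* m ℤ.+ C)
            × ν≡0 p (A ℤ.* (+ toℕ n) ℤ.+ B ℤ.* m ℤ.+ C))))
lemma4p8 p p-prime 48<p N N≢0 p²∣N F sol
  with Solution.good-window p N p-prime F sol 48<p (ℕD.∣⇒≤ {{N≢0}} p²∣N)
... | n₀ , m₀ , n₀+3<N , good =
  n₀ , + m₀ , A , B , C₀ , subst (ℕ._≤ N) (sym (ℕP.+-suc n₀ 3)) n₀+3<N ,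
  (λ (p∣A , p∣B , p∣C₀) → coefficients-nondegenerate (∣ᵤ⇒∣ p∣A , ∣ᵤ⇒∣ p∣B , ∣ᵤ⇒∣ p∣C₀)) ,
  λ n m n₀≤n n≤n₀+3 m₀≤m m≤m₀+3 → value-residue n m (window-affine n m n₀≤n n≤n₀+3 m₀≤m m≤m₀+3)
  where
  open Solution p N p-prime F sol
  open Window (ℕP.<-trans (ℕP.m<m+n 12 (s≤s z≤n)) 48<p) n₀ m₀ n₀+3<N good
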